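{- Let $D$ be a digraph with $n$ vertices, let $u$ be a vertex of outdegree $1$ with outgoing arc $uw$, and let $v$ be a vertex of indegree $1$ with incoming arc $zv$. Let $A=[a_{i,j}]\in Q^0(D)$ with $a_{u,u}=a_{u,w}=a_{v,v}=a_{z,v}=0$. If $u\neq v$ and $u$ is not adjacent to $v$, then $A$ does not have the SP.
   Context: Digraphs are finite, without loops or parallel arcs, with vertex set $\{1,\dots,n\}$. For a digraph $D$, $Q^0(D)$ is the set of real $n\times n$ matrices $B=[b_{i,j}]$ with $b_{i,j}=0$ whenever $i\neq j$ and there is no arc from $i$ to $j$. "Adjacent" means joined by an arc in either direction. The support of a vector $x$ is $\mathrm{supp}(x)=\{i:x_i\neq0\}$. Subsets $R,S$ (in this order) of $V(D)$ touch if $R\cap S\neq\emptyset$ or there is an arc from a vertex of $R$ to a vertex of $S$. A matrix $A$ has the Support Property (SP) with respect to $D$ if for every nonzero $x$ with $x^TA=0$ and every nonzero $y$ with $Ay=0$, $\mathrm{supp}(x)$ and $\mathrm{supp}(y)$ touch. -}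

module Defs where

open import Level using (Level; _⊔_; suc)
open import Data.Nat using (ℕ)
import Data.Nat as ℕ
open import Data.Fin using (Fin) renaming (zero to fzero; suc to fsuc)
open import Data.Product using (Σ; _×_; ∃; ∃-syntax)
open import Data.Sum using (_⊎_)
open import Relation.Nullary using (¬_)
open import Relation.Binary.PropositionalEquality using (_≡_; _≢_)
open import Algebra.Bundles using (CommutativeRing)

record Field (c ℓ : Level) : Set (suc (c ⊔ ℓ)) where
  field
    commutativeRing : CommutativeRing c ℓ
  open CommutativeRing commutativeRing public
  field
    0≉1     : ¬ (0# ≈ 1#)
    inverse : ∀ x → ¬ (x ≈ 0#) → ∃[ y ] (x * y ≈ 1#)

record Digraph (n : ℕ) : Set₁ where
  field
    Arc    : Fin n → Fin n → Set
    noLoop : ∀ i → ¬ Arc i i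
open Digraph public

Adjacent : ∀ {n} → Digraph n → Fin n → Fin n → Set
Adjacent D i j = Arc D i j ⊎ Arc D j i

OutdegOneVia : ∀ {n} → Digraph n → Fin n → Fin n → Set
OutdegOneVia D u w = Arc D u w × (∀ j → Arc D u j → j ≡ w)

IndegOneVia : ∀ {n} → Digraph n → Fin n → Fin n → Set
IndegOneVia D z v = Arc D z v × (∀ i → Arc D i v → i ≡ z)

module _ {c ℓ} (F : Field c ℓ) where
  open Field F

  Matrix : ℕ → Set c
  Matrix n = Fin n → Fin n → Carrier

  Vector : ℕ → Set c
  Vector n = Fin n → Carrier

  ∑ : ∀ {n} → (Fin n → Carrier) → Carrier
  ∑ {ℕ.zero}  f = 0#
  ∑ {ℕ.suc n} f = f fzero + ∑ (λ i → f (fsuc i))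

  InQ0 : ∀ {n} → Digraph n → Matrix n → Set ℓ
  InQ0 D B = ∀ i j → i ≢ j → ¬ Arc D i j → B i j ≈ 0#

  NonzeroVec : ∀ {n} → Vector n → Set ℓ
  NonzeroVec x = ¬ (∀ i → x i ≈ 0#)

  LeftNull : ∀ {n} → Matrix n → Vector n → Set ℓ
  LeftNull A x = ∀ j → ∑ (λ i → x i * A i j) ≈ 0#

  RightNull : ∀ {n} → Matrix n → Vector n → Set ℓ
  RightNull A y = ∀ i → ∑ (λ j → A i j * y j) ≈ 0#

  InSupp : ∀ {n} → Vector n → Fin n → Set ℓ
  InSupp x i = ¬ (x i ≈ 0#)

  Touch : ∀ {n} → Digraph n → Vector n → Vector n → Set ℓ
  Touch D x y =
    (∃[ i ] (InSupp x i × InSupp y i))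
    ⊎ (∃[ i ] ∃[ j ] (InSupp x i × InSupp y j × Arc D i j))

  SP : ∀ {n} → Digraph n → Matrix n → Set (c ⊔ ℓ)
  SP D A = ∀ x y → NonzeroVec x → LeftNull A x →
           NonzeroVec y → RightNull A y → Touch D x y

{-# OPTIONS --safe #-}
module Submission where

-- Since the only arc leaving u is u → w and a_{u,u} = a_{u,w} = 0, row u of A
-- vanishes, so the unit vector e_u satisfies e_uᵀA = 0; dually column v vanishes
-- and A e_v = 0.  The supports {u} and {v} touch only if u = v or u → v.

open import Defs
open import Data.Nat using (ℕ)
import Data.Nat as ℕ
open import Data.Fin using (Fin; _≟_) renaming (zero to fzero; suc to fsuc)
open import Data.Product using (_,_)
open import Data.Sum using (_⊎_; inj₁; inj₂)
open import Data.Empty using (⊥-elim)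
open import Relation.Nullary using (¬_; yes; no)
open import Relation.Binary.PropositionalEquality using (_≡_; _≢_; refl; sym)

module _ {c ℓ} (F : Field c ℓ) where
  open Field F hiding (refl; sym)
  private
    ≈-refl = Field.refl F

  ∑-zero : ∀ {n} (f : Fin n → Carrier) → (∀ i → f i ≈ 0#) → ∑ F f ≈ 0#
  ∑-zero {ℕ.zero}  f f≈0 = ≈-refl
  ∑-zero {ℕ.suc n} f f≈0 =
    trans (+-cong (f≈0 fzero) (∑-zero (λ i → f (fsuc i)) (λ i → f≈0 (fsuc i))))
          (+-identityˡ 0#)

  unitVector : ∀ {n} → Fin n → Vector F n
  unitVector u i with i ≟ u
  ... | yes _ = 1#
  ... | no _  = 0#

  unitVector-nonzero : ∀ {n} (u : Fin n) → NonzeroVec F (unitVector u)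
  unitVector-nonzero u eᵤ≈0 with u ≟ u | eᵤ≈0 u
  ... | yes _  | 1≈0 = 0≉1 (Field.sym F 1≈0)
  ... | no u≢u | _   = u≢u refl

  unitVector-supp : ∀ {n} (u i : Fin n) → InSupp F (unitVector u) i → i ≡ u
  unitVector-supp u i eᵤᵢ≉0 with i ≟ u
  ... | yes i≡u = i≡u
  ... | no _    = ⊥-elim (eᵤᵢ≉0 ≈-refl)

  unitVector-*-zero : ∀ {n} (u : Fin n) (f : Vector F n) → f u ≈ 0# →
                      ∀ i → unitVector u i * f i ≈ 0#
  unitVector-*-zero u f fᵤ≈0 i with i ≟ u
  ... | yes refl = trans (*-identityˡ (f u)) fᵤ≈0
  ... | no _     = zeroˡ (f i)

  zeroRow⇒LeftNull : ∀ {n} (A : Matrix F n) (u : Fin n) →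
                     (∀ j → A u j ≈ 0#) → LeftNull F A (unitVector u)
  zeroRow⇒LeftNull A u rowᵤ≈0 j =
    ∑-zero _ (unitVector-*-zero u (λ i → A i j) (rowᵤ≈0 j))

  zeroColumn⇒RightNull : ∀ {n} (A : Matrix F n) (v : Fin n) →
                         (∀ i → A i v ≈ 0#) → RightNull F A (unitVector v)
  zeroColumn⇒RightNull A v colᵥ≈0 i =
    ∑-zero _ (λ j → trans (*-comm (A i j) (unitVector v j))
                          (unitVector-*-zero v (A i) (colᵥ≈0 i) j))

  Touch-unitVector : ∀ {n} (D : Digraph n) (u v : Fin n) →
                     Touch F D (unitVector u) (unitVector v) → u ≡ v ⊎ Arc D u v
  Touch-unitVector D u v (inj₁ (i , eᵤᵢ≉0 , eᵥᵢ≉0))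
    with unitVector-supp u i eᵤᵢ≉0 | unitVector-supp v i eᵥᵢ≉0
  ... | refl | refl = inj₁ refl
  Touch-unitVector D u v (inj₂ (i , j , eᵤᵢ≉0 , eᵥⱼ≉0 , i→j))
    with unitVector-supp u i eᵤᵢ≉0 | unitVector-supp v j eᵥⱼ≉0
  ... | refl | refl = inj₂ i→j

  SP⇒zeroRow-zeroColumn-touch : ∀ {n} (D : Digraph n) (A : Matrix F n) → SP F D A →
                                ∀ u v → (∀ j → A u j ≈ 0#) → (∀ i → A i v ≈ 0#) →
                                u ≡ v ⊎ Arc D u v
  SP⇒zeroRow-zeroColumn-touch D A sp u v rowᵤ≈0 colᵥ≈0 =
    Touch-unitVector D u v
      (sp (unitVector u) (unitVector v)
          (unitVector-nonzero u) (zeroRow⇒LeftNull A u rowᵤ≈0)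
          (unitVector-nonzero v) (zeroColumn⇒RightNull A v colᵥ≈0))

  OutdegOneVia⇒zeroRow : ∀ {n} (D : Digraph n) (A : Matrix F n) → InQ0 F D A →
                         ∀ {u w} → OutdegOneVia D u w →
                         A u u ≈ 0# → A u w ≈ 0# → ∀ j → A u j ≈ 0#
  OutdegOneVia⇒zeroRow D A A∈Q⁰ {u} {w} (_ , onlyArc) auu≈0 auw≈0 j
    with j ≟ u | j ≟ w
  ... | yes refl | _        = auu≈0
  ... | no _     | yes refl = auw≈0
  ... | no j≢u   | no j≢w   =
    A∈Q⁰ u j (λ u≡j → j≢u (sym u≡j)) (λ u→j → j≢w (onlyArc j u→j))

  IndegOneVia⇒zeroColumn : ∀ {n} (D : Digraph n) (A : Matrix F n) → InQ0 F D A →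
                           ∀ {z v} → IndegOneVia D z v →
                           A v v ≈ 0# → A z v ≈ 0# → ∀ i → A i v ≈ 0#
  IndegOneVia⇒zeroColumn D A A∈Q⁰ {z} {v} (_ , onlyArc) avv≈0 azv≈0 i
    with i ≟ v | i ≟ z
  ... | yes refl | _        = avv≈0
  ... | no _     | yes refl = azv≈0
  ... | no i≢v   | no i≢z   = A∈Q⁰ i v i≢v (λ i→v → i≢z (onlyArc i i→v))

mainTheorem12 : ∀ {c ℓ} (F : Field c ℓ) {n : ℕ} (D : Digraph n) (u w v z : Fin n)
    → OutdegOneVia D u w → IndegOneVia D z v
    → (A : Matrix F n) → InQ0 F D A
    → Field._≈_ F (A u u) (Field.0# F) → Field._≈_ F (A u w) (Field.0# F)
    → Field._≈_ F (A v v) (Field.0# F) → Field._≈_ F (A z v) (Field.0# F)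
    → u ≢ v → ¬ Adjacent D u v
    → ¬ SP F D A
mainTheorem12 F D u w v z outdeg indeg A A∈Q⁰ auu≈0 auw≈0 avv≈0 azv≈0 u≢v ¬adj sp
  with SP⇒zeroRow-zeroColumn-touch F D A sp u v
         (OutdegOneVia⇒zeroRow F D A A∈Q⁰ outdeg auu≈0 auw≈0)
         (IndegOneVia⇒zeroColumn F D A A∈Q⁰ indeg avv≈0 azv≈0)
... | inj₁ u≡v = u≢v u≡v
... | inj₂ u→v = ¬adj (inj₁ u→v)
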